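{- Let $T=(V,A)$ be an indecomposable tournament such that $|V|$ is even and $|V|\ge 6$. Then for each $x\in V$ there is $y\in V\setminus\{x\}$ such that $T-y$ is indecomposable.
   Context: A tournament $T=(V,A)$ is a finite vertex set $V$ with an arc set $A$ of ordered pairs of distinct vertices such that for distinct $x,y\in V$, exactly one of $(x,y),(y,x)$ lies in $A$; write $x\to y$ for $(x,y)\in A$. $T-y$ denotes the subtournament induced on $V\setminus\{y\}$. A subset $I\subseteq V$ is an interval of $T$ if for every $x\in V\setminus I$, either $x\to z$ for all $z\in I$ or $z\to x$ for all $z\in I$. The sets $\emptyset$, $V$ and singletons are trivial intervals; $T$ is indecomposable if all its intervals are trivial. -}

module Defs where

open import Data.Nat using (ℕ; suc; _≥_)
open import Data.Nat.Properties using ()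
open import Data.Fin using (Fin; punchIn)
open import Data.Fin.Subset using (Subset; _∈_; _∉_; ⊥; ⊤; ⁅_⁆)
open import Data.Product using (Σ; ∃; _×_; _,_)
open import Data.Sum using (_⊎_)
open import Relation.Binary.PropositionalEquality using (_≡_; _≢_)
open import Relation.Nullary using (¬_)
open import Level using (0ℓ)

record Tournament (n : ℕ) : Set₁ where
  field
    _⟶_      : Fin n → Fin n → Set
    irrefl   : ∀ x → ¬ (x ⟶ x)
    total    : ∀ x y → x ≢ y → (x ⟶ y) ⊎ (y ⟶ x)
    asym     : ∀ x y → x ⟶ y → ¬ (y ⟶ x)

open Tournament public

IsInterval : ∀ {n} → Tournament n → Subset n → Set
IsInterval T I = ∀ x → x ∉ I →
  ((∀ z → z ∈ I → _⟶_ T x z) ⊎ (∀ z → z ∈ I → _⟶_ T z x))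

IsTrivial : ∀ {n} → Subset n → Set
IsTrivial {n} I = (I ≡ ⊥) ⊎ (I ≡ ⊤) ⊎ (∃ λ (z : Fin n) → I ≡ ⁅ z ⁆)

Indecomposable : ∀ {n} → Tournament n → Set
Indecomposable {n} T = ∀ (I : Subset n) → IsInterval T I → IsTrivial I

-- T - y : the subtournament induced on V ∖ {y}, with V ∖ {y} ≅ Fin m via punchIn y
delete : ∀ {m} → Tournament (suc m) → Fin (suc m) → Tournament m
delete T y = record
  { _⟶_ = λ a b → _⟶_ T (punchIn y a) (punchIn y b)
  ; irrefl = λ a → irrefl T (punchIn y a)
  ; total = λ a b a≢b → total T (punchIn y a) (punchIn y b)
              (λ e → a≢b (Data.Fin.Properties.punchIn-injective y a b e))
  ; asym = λ a b → asym T (punchIn y a) (punchIn y b)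
  }
  where import Data.Fin.Properties

Even : ℕ → Set
Even n = ∃ λ k → n ≡ k Data.Nat.+ k
  where import Data.Nat

-- Start from a 3-cycle x → p → q → x through the given vertex x: it exists because otherwise the
-- out- and in-neighbourhoods of x would be intervals, hence of size at most one, and |V| ≤ 3.
-- A 3-cycle is indecomposable, and by the Ehrenfeucht–Rozenberg theorem an indecomposable
-- X ⊆ V with at least two vertices outside extends to an indecomposable X ∪ {a, b}. As |V| is
-- even, |V ∖ X| stays odd, so iterating from the 3-cycle ends with X = V ∖ {y} for some y ≠ x.
--
-- If X ∪ {a, b} were decomposable for every pair
-- a, b outside X, then inspecting the possible intervals of X ∪ {a, b} shows in turn that no
-- outside vertex sees X uniformly, that none of them behaves towards X like a vertex of X, and
-- hence that all of them see X alike; but then V ∖ X is a nontrivial interval of T.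

module Submission where

open import Data.Bool using (Bool; true; false; not)
open import Data.Bool.Properties using (¬-not) renaming (_≟_ to _≟ᵇ_)
open import Data.Empty using (⊥; ⊥-elim)
open import Data.Fin using (Fin; zero; suc; punchIn; punchOut)
open import Data.Fin.Properties
  using (_≟_; any?; all?; injective⇒≤; punchIn-injective; punchInᵢ≢i; punchIn-punchOut)
open import Data.Fin.Subset
  using (Subset; _∈_; _∉_; _⊆_; ⊤; ⁅_⁆; _∪_; ∁; _-_; ∣_∣; Nonempty; inside; outside)
open import Data.Fin.Subset.Properties
  using ( _∈?_; x∈⁅x⁆; x∈⁅y⁆⇒x≡y; x≢y⇒x∉⁅y⁆; x∉⁅y⁆⇒x≢y; x∈p∪q⁺; x∈p∪q⁻; ∪-identityʳ
        ; x∉p⇒x∈∁p; x∈∁p⇒x∉p; x∉∁p⇒x∈p; x∈p⇒x∉∁p; ∈⊤; ⊆⊤; ∉⊥; ⊆-antisym; nonempty?; Empty-unique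
        ; ∣⊥∣≡0; ∣⁅x⁆∣≡1; ∣∁p∣≡n∸∣p∣; x∈p⇒∣p-x∣<∣p∣ )
open import Data.Nat using (ℕ; zero; suc; _+_; _∸_; _≤_; _<_; _≥_)
open import Data.Nat.Properties using (suc-injective; +-suc; 0≢1+n; n≮0; <⇒≱; ≤-trans; m≤n+m)
open import Data.Product using (∃; _×_; _,_; proj₁; proj₂)
open import Data.Sum using (_⊎_; inj₁; inj₂; [_,_]′)
open import Data.Vec using (_∷_; tabulate; here; there)
open import Data.Vec.Properties using (lookup∘tabulate; []=⇒lookup; lookup⇒[]=)
open import Function using (_∘_; id)
open import Relation.Binary.PropositionalEquality
open ≡-Reasoning
open import Relation.Nullary using (¬_; Dec; yes; no; does; contradiction)
open import Relation.Nullary.Decidable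
  using (dec-true; dec-false; _×-dec_; _⊎-dec_; _→-dec_; ¬?; map′; decidable-stable)
open import Relation.Unary using (Pred; Decidable)

open import Defs

module _ {n : ℕ} where

  ⟦_⟧ : ∀ {ℓ} {P : Pred (Fin n) ℓ} → Decidable P → Subset n
  ⟦ P? ⟧ = tabulate (does ∘ P?)

  x∈⟦P⟧⁺ : ∀ {ℓ} {P : Pred (Fin n) ℓ} (P? : Decidable P) {x} → P x → x ∈ ⟦ P? ⟧
  x∈⟦P⟧⁺ P? {x} Px = lookup⇒[]= x _ (trans (lookup∘tabulate (does ∘ P?) x) (dec-true (P? x) Px))

  x∈⟦P⟧⁻ : ∀ {ℓ} {P : Pred (Fin n) ℓ} (P? : Decidable P) {x} → x ∈ ⟦ P? ⟧ → P x
  x∈⟦P⟧⁻ P? {x} x∈P with P? x | trans (sym (lookup∘tabulate (does ∘ P?) x)) ([]=⇒lookup x∈P)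
  ... | yes Px | _ = Px

  x∈p∧y∉p⇒x≢y : ∀ {x y} {p : Subset n} → x ∈ p → y ∉ p → x ≢ y
  x∈p∧y∉p⇒x≢y x∈p y∉p refl = y∉p x∈p

  x∉p∪q⇒x∉p : ∀ {x} {p q : Subset n} → x ∉ p ∪ q → x ∉ p
  x∉p∪q⇒x∉p x∉p∪q x∈p = x∉p∪q (x∈p∪q⁺ (inj₁ x∈p))

  x∉p∪q⇒x∉q : ∀ {x} {p q : Subset n} → x ∉ p ∪ q → x ∉ q
  x∉p∪q⇒x∉q x∉p∪q x∈q = x∉p∪q (x∈p∪q⁺ (inj₂ x∈q))

  x∉p∪q⁺ : ∀ {x} (p q : Subset n) → x ∉ p → x ∉ q → x ∉ p ∪ q
  x∉p∪q⁺ p q x∉p x∉q x∈p∪q with x∈p∪q⁻ p q x∈p∪q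
  ... | inj₁ x∈p = x∉p x∈p
  ... | inj₂ x∈q = x∉q x∈q

  _∪⁅_,_⁆ : Subset n → Fin n → Fin n → Subset n
  p ∪⁅ a , b ⁆ = (p ∪ ⁅ a ⁆) ∪ ⁅ b ⁆

  p⊆p∪⁅a,b⁆ : ∀ {p a b} → p ⊆ p ∪⁅ a , b ⁆
  p⊆p∪⁅a,b⁆ x∈p = x∈p∪q⁺ (inj₁ (x∈p∪q⁺ (inj₁ x∈p)))

  a∈p∪⁅a,b⁆ : ∀ {p} a {b} → a ∈ p ∪⁅ a , b ⁆
  a∈p∪⁅a,b⁆ a = x∈p∪q⁺ (inj₁ (x∈p∪q⁺ (inj₂ (x∈⁅x⁆ a))))

  b∈p∪⁅a,b⁆ : ∀ {p a} b → b ∈ p ∪⁅ a , b ⁆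
  b∈p∪⁅a,b⁆ b = x∈p∪q⁺ (inj₂ (x∈⁅x⁆ b))

  x∈p∪⁅a,b⁆⁻ : ∀ p a b {x} → x ∈ p ∪⁅ a , b ⁆ → x ∈ p ⊎ x ≡ a ⊎ x ≡ b
  x∈p∪⁅a,b⁆⁻ p a b x∈ with x∈p∪q⁻ (p ∪ ⁅ a ⁆) ⁅ b ⁆ x∈
  ... | inj₂ x∈⁅b⁆ = inj₂ (inj₂ (x∈⁅y⁆⇒x≡y b x∈⁅b⁆))
  ... | inj₁ x∈p∪⁅a⁆ with x∈p∪q⁻ p ⁅ a ⁆ x∈p∪⁅a⁆
  ...   | inj₁ x∈p   = inj₁ x∈p
  ...   | inj₂ x∈⁅a⁆ = inj₂ (inj₁ (x∈⁅y⁆⇒x≡y a x∈⁅a⁆))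

  x∈⁅x⁆∪⁅p,q⁆⁻ : ∀ x p q {z} → z ∈ ⁅ x ⁆ ∪⁅ p , q ⁆ → z ≡ x ⊎ z ≡ p ⊎ z ≡ q
  x∈⁅x⁆∪⁅p,q⁆⁻ x p q z∈Y with x∈p∪⁅a,b⁆⁻ ⁅ x ⁆ p q z∈Y
  ... | inj₁ z∈⁅x⁆ = inj₁ (x∈⁅y⁆⇒x≡y x z∈⁅x⁆)
  ... | inj₂ z≡p∨q = inj₂ z≡p∨q

  record AtLeastThree (X : Subset n) : Set where
    constructor three
    field
      x₀ x₁ x₂ : Fin n
      x₀∈X : x₀ ∈ X
      x₁∈X : x₁ ∈ X
      x₂∈X : x₂ ∈ X
      x₀≢x₁ : x₀ ≢ x₁
      x₀≢x₂ : x₀ ≢ x₂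
      x₁≢x₂ : x₁ ≢ x₂

  AtLeastThree-mono : ∀ {X Y} → X ⊆ Y → AtLeastThree X → AtLeastThree Y
  AtLeastThree-mono X⊆Y (three x₀ x₁ x₂ x₀∈X x₁∈X x₂∈X x₀≢x₁ x₀≢x₂ x₁≢x₂) =
    three x₀ x₁ x₂ (X⊆Y x₀∈X) (X⊆Y x₁∈X) (X⊆Y x₂∈X) x₀≢x₁ x₀≢x₂ x₁≢x₂

  two-others : ∀ {X} → AtLeastThree X → ∀ u →
    ∃ λ w → ∃ λ w′ → w ∈ X × w′ ∈ X × w ≢ w′ × w ≢ u × w′ ≢ u
  two-others (three x₀ x₁ x₂ x₀∈X x₁∈X x₂∈X x₀≢x₁ x₀≢x₂ x₁≢x₂) u with x₀ ≟ u | x₁ ≟ u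
  ... | yes refl | _        = x₁ , x₂ , x₁∈X , x₂∈X , x₁≢x₂ , ≢-sym x₀≢x₁ , ≢-sym x₀≢x₂
  ... | no x₀≢u  | yes refl = x₀ , x₂ , x₀∈X , x₂∈X , x₀≢x₂ , x₀≢u , ≢-sym x₁≢x₂
  ... | no x₀≢u  | no x₁≢u  = x₀ , x₁ , x₀∈X , x₁∈X , x₀≢x₁ , x₀≢u , x₁≢u

  another : ∀ {X} → AtLeastThree X → ∀ u u′ → ∃ λ w → w ∈ X × w ≢ u × w ≢ u′
  another t u u′ with two-others t u
  ... | w , w′ , w∈X , w′∈X , w≢w′ , w≢u , w′≢u with w ≟ u′
  ...   | yes refl = w′ , w′∈X , w′≢u , ≢-sym w≢w′
  ...   | no w≢u′  = w , w∈X , w≢u , w≢u′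

∃-Bool? : ∀ {ℓ} {P : Bool → Set ℓ} → Dec (P true) → Dec (P false) → Dec (∃ P)
∃-Bool? (yes p)  _        = yes (true , p)
∃-Bool? (no _)   (yes q)  = yes (false , q)
∃-Bool? (no ¬p)  (no ¬q)  = no λ { (true , p) → ¬p p ; (false , q) → ¬q q }

≤-if-covered-by-subsingletons : ∀ {k n} (C : Fin k → Fin n → Set) →
  (∀ z → ∃ λ i → C i z) → (∀ i {z z′} → C i z → C i z′ → z ≡ z′) → n ≤ k
≤-if-covered-by-subsingletons C cover unique = injective⇒≤ {f = proj₁ ∘ cover} λ {z} {z′} same →
  unique _ (subst (λ i → C i z) same (proj₂ (cover z))) (proj₂ (cover z′))

∣∁p∣≡1+∣∁[p∪⁅x⁆]∣ : ∀ {n} {p : Subset n} {x} → x ∉ p → ∣ ∁ p ∣ ≡ suc ∣ ∁ (p ∪ ⁅ x ⁆) ∣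
∣∁p∣≡1+∣∁[p∪⁅x⁆]∣ {p = inside  ∷ p} {zero}  x∉p = contradiction here x∉p
∣∁p∣≡1+∣∁[p∪⁅x⁆]∣ {p = outside ∷ p} {zero}  x∉p = cong (suc ∘ ∣_∣ ∘ ∁) (sym (∪-identityʳ p))
∣∁p∣≡1+∣∁[p∪⁅x⁆]∣ {p = inside  ∷ p} {suc x} x∉p = ∣∁p∣≡1+∣∁[p∪⁅x⁆]∣ (x∉p ∘ there)
∣∁p∣≡1+∣∁[p∪⁅x⁆]∣ {p = outside ∷ p} {suc x} x∉p = cong suc (∣∁p∣≡1+∣∁[p∪⁅x⁆]∣ (x∉p ∘ there))

∣∁p∣≡2+∣∁[p∪⁅a,b⁆]∣ : ∀ {n} {p : Subset n} {a b} → a ∉ p → b ∉ p → a ≢ b →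
  ∣ ∁ p ∣ ≡ suc (suc ∣ ∁ (p ∪⁅ a , b ⁆) ∣)
∣∁p∣≡2+∣∁[p∪⁅a,b⁆]∣ {p = p} {a} a∉p b∉p a≢b =
  trans (∣∁p∣≡1+∣∁[p∪⁅x⁆]∣ a∉p)
        (cong suc (∣∁p∣≡1+∣∁[p∪⁅x⁆]∣ (x∉p∪q⁺ p ⁅ a ⁆ b∉p (x≢y⇒x∉⁅y⁆ (≢-sym a≢b)))))

∣p∣≡suc⇒nonempty : ∀ {n k} {p : Subset n} → ∣ p ∣ ≡ suc k → Nonempty p
∣p∣≡suc⇒nonempty {n} {p = p} ∣p∣≡1+k = decidable-stable (nonempty? p) λ empty →
  0≢1+n (trans (sym (∣⊥∣≡0 n)) (trans (cong ∣_∣ (sym (Empty-unique empty))) ∣p∣≡1+k))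

∣p∣≡0⇒x∉p : ∀ {n x} {p : Subset n} → ∣ p ∣ ≡ 0 → x ∉ p
∣p∣≡0⇒x∉p {x = x} {p} ∣p∣≡0 x∈p = n≮0 (subst (∣ p - x ∣ <_) ∣p∣≡0 (x∈p⇒∣p-x∣<∣p∣ x∈p))

two-outside : ∀ {n k} {X : Subset n} → ∣ ∁ X ∣ ≡ suc (suc k) → ∃ λ a → ∃ λ b → a ∉ X × b ∉ X × a ≢ b
two-outside ∣∁X∣≡2+k =
  let (a , a∈∁X) = ∣p∣≡suc⇒nonempty ∣∁X∣≡2+k
      a∉X        = x∈∁p⇒x∉p a∈∁X
      (b , b∈∁Y) = ∣p∣≡suc⇒nonempty (suc-injective (trans (sym (∣∁p∣≡1+∣∁[p∪⁅x⁆]∣ a∉X)) ∣∁X∣≡2+k))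
      b∉Y        = x∈∁p⇒x∉p b∈∁Y
  in a , b , a∉X , x∉p∪q⇒x∉p b∉Y , ≢-sym (x∉⁅y⁆⇒x≢y (x∉p∪q⇒x∉q b∉Y))

punchIn-onto : ∀ {n} {y v : Fin (suc n)} → v ≢ y → ∃ λ a → punchIn y a ≡ v
punchIn-onto v≢y = punchOut (v≢y ∘ sym) , punchIn-punchOut (v≢y ∘ sym)

∣∁⁅x⁆∣≡n : ∀ {n} (x : Fin (suc n)) → ∣ ∁ ⁅ x ⁆ ∣ ≡ n
∣∁⁅x⁆∣≡n {n} x = trans (∣∁p∣≡n∸∣p∣ ⁅ x ⁆) (cong (suc n ∸_) (∣⁅x⁆∣≡1 x))

odd-remainder : ∀ k c → k + k ≡ suc (suc (suc c)) → ∃ λ j → c ≡ suc (j + j)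
odd-remainder zero          c ()
odd-remainder (suc zero)    c ()
odd-remainder (suc (suc j)) c k+k≡3+c = j , (begin
  c            ≡⟨ suc-injective (trans (sym (suc-injective (suc-injective k+k≡3+c))) (+-suc j (suc j))) ⟩
  j + suc j    ≡⟨ +-suc j j ⟩
  suc (j + j)  ∎)

module Indecomposability {n : ℕ} (T : Tournament n) where

  _⟶?_ : ∀ x y → Dec (_⟶_ T x y)
  x ⟶? y with x ≟ y
  ... | yes refl = no (irrefl T x)
  ... | no x≢y with total T x y x≢y
  ...   | inj₁ x⟶y = yes x⟶y
  ...   | inj₂ y⟶x = no (asym T y x y⟶x)

  infix 5 _⟶ᵇ_

  -- Opaque so that the vertices can be inferred from an equation x ⟶ᵇ y ≡ b.
  opaque
    _⟶ᵇ_ : Fin n → Fin n → Bool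
    x ⟶ᵇ y = does (x ⟶? y)

    ⟶ᵇ-complete : ∀ {x y} → _⟶_ T x y → x ⟶ᵇ y ≡ true
    ⟶ᵇ-complete {x} {y} = dec-true (x ⟶? y)

    ⟶ᵇ-complete′ : ∀ {x y} → ¬ _⟶_ T x y → x ⟶ᵇ y ≡ false
    ⟶ᵇ-complete′ {x} {y} = dec-false (x ⟶? y)

    ⟶ᵇ-sound : ∀ {x y} → x ⟶ᵇ y ≡ true → _⟶_ T x y
    ⟶ᵇ-sound {x} {y} x⟶y with x ⟶? y
    ... | yes x⟶y = x⟶y

  ⟶ᵇ-irrefl : ∀ x → x ⟶ᵇ x ≡ false
  ⟶ᵇ-irrefl x = ⟶ᵇ-complete′ (irrefl T x)

  ⟶ᵇ-flip : ∀ {x y} → x ≢ y → y ⟶ᵇ x ≡ not (x ⟶ᵇ y)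
  ⟶ᵇ-flip {x} {y} x≢y with total T x y x≢y
  ... | inj₁ x⟶y rewrite ⟶ᵇ-complete x⟶y = ⟶ᵇ-complete′ (asym T x y x⟶y)
  ... | inj₂ y⟶x rewrite ⟶ᵇ-complete′ (asym T y x y⟶x) = ⟶ᵇ-complete y⟶x

  ⟶ᵇ-reverse : ∀ {x y} → x ≢ y → x ⟶ᵇ y ≡ false → y ⟶ᵇ x ≡ true
  ⟶ᵇ-reverse x≢y x⟶y≡false rewrite ⟶ᵇ-flip x≢y | x⟶y≡false = refl

  ⟶ᵇ⇒≢ : ∀ {x y} → x ⟶ᵇ y ≡ true → x ≢ y
  ⟶ᵇ⇒≢ {x} x⟶x refl with () ← trans (sym x⟶x) (⟶ᵇ-irrefl x)

  ⟶ᵇ-flip-cong : ∀ {x y x′ y′} → x ≢ y → x′ ≢ y′ → x ⟶ᵇ y ≡ x′ ⟶ᵇ y′ → y ⟶ᵇ x ≡ y′ ⟶ᵇ x′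
  ⟶ᵇ-flip-cong x≢y x′≢y′ eq rewrite ⟶ᵇ-flip x≢y | ⟶ᵇ-flip x′≢y′ = cong not eq

  Uniform : Subset n → Fin n → Bool → Set
  Uniform X v d = ∀ {z} → z ∈ X → v ⟶ᵇ z ≡ d

  -- I ∩ X is an interval of T[X]; the boolean d tells whether v dominates I ∩ X or is dominated by it.
  IsIntervalIn : Subset n → Subset n → Set
  IsIntervalIn X I = ∀ {v} → v ∈ X → v ∉ I → ∃ λ d → ∀ {z} → z ∈ X → z ∈ I → v ⟶ᵇ z ≡ d

  IsTrivialIn : Subset n → Subset n → Set
  IsTrivialIn X I = (∀ {z z′} → z ∈ X → z ∈ I → z′ ∈ X → z′ ∈ I → z ≡ z′) ⊎ X ⊆ I

  IndecomposableOn : Subset n → Set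
  IndecomposableOn X = ∀ I → IsIntervalIn X I → IsTrivialIn X I

  interval-same-side : ∀ {X I} → IsIntervalIn X I →
    ∀ {w c c′} → w ∈ X → w ∉ I → c ∈ X → c ∈ I → c′ ∈ X → c′ ∈ I → w ⟶ᵇ c ≡ w ⟶ᵇ c′
  interval-same-side I-int w∈X w∉I c∈X c∈I c′∈X c′∈I =
    let (d , w⟶I) = I-int w∈X w∉I in trans (w⟶I c∈X c∈I) (sym (w⟶I c′∈X c′∈I))

  IsIntervalIn-mono : ∀ {X Y I} → X ⊆ Y → IsIntervalIn Y I → IsIntervalIn X I
  IsIntervalIn-mono X⊆Y I-int v∈X v∉I =
    let (d , v⟶I) = I-int (X⊆Y v∈X) v∉I in d , λ z∈X → v⟶I (X⊆Y z∈X)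

  trivial-if-⊆⁅⁆ : ∀ {X I} c → (∀ {z} → z ∈ X → z ∈ I → z ≡ c) → IsTrivialIn X I
  trivial-if-⊆⁅⁆ c ⊆c = inj₁ λ z∈X z∈I z′∈X z′∈I → trans (⊆c z∈X z∈I) (sym (⊆c z′∈X z′∈I))

  IndecomposableOn-resp : ∀ {X Y} → X ⊆ Y → Y ⊆ X → IndecomposableOn X → IndecomposableOn Y
  IndecomposableOn-resp X⊆Y Y⊆X indX I I-int with indX I (IsIntervalIn-mono X⊆Y I-int)
  ... | inj₁ sub = inj₁ λ z∈Y z∈I z′∈Y z′∈I → sub (Y⊆X z∈Y) z∈I (Y⊆X z′∈Y) z′∈I
  ... | inj₂ X⊆I = inj₂ (X⊆I ∘ Y⊆X)

  indecomposable⇒IndecomposableOn⊤ : Indecomposable T → IndecomposableOn ⊤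
  indecomposable⇒IndecomposableOn⊤ indec I I-int with indec I I-is-interval
    where
    I-is-interval : IsInterval T I
    I-is-interval v v∉I with I-int ∈⊤ v∉I
    ... | true  , v⟶I = inj₁ λ z z∈I → ⟶ᵇ-sound (v⟶I ∈⊤ z∈I)
    ... | false , v⟶I = inj₂ λ z z∈I →
            ⟶ᵇ-sound (⟶ᵇ-reverse (≢-sym (x∈p∧y∉p⇒x≢y z∈I v∉I)) (v⟶I ∈⊤ z∈I))
  ... | inj₁ I≡∅                = inj₁ λ {z} _ z∈I → ⊥-elim (∉⊥ (subst (z ∈_) I≡∅ z∈I))
  ... | inj₂ (inj₁ I≡⊤)         = inj₂ λ {z} _ → subst (z ∈_) (sym I≡⊤) ∈⊤
  ... | inj₂ (inj₂ (u , I≡⁅u⁆)) = trivial-if-⊆⁅⁆ u λ {z} _ z∈I → x∈⁅y⁆⇒x≡y u (subst (z ∈_) I≡⁅u⁆ z∈I)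

  IndecomposableOn⊤⇒indecomposable : IndecomposableOn ⊤ → Indecomposable T
  IndecomposableOn⊤⇒indecomposable ind I I-is-interval with ind I I-int
    where
    I-int : IsIntervalIn ⊤ I
    I-int {v} _ v∉I with I-is-interval v v∉I
    ... | inj₁ v⟶I = true  , λ {z} _ z∈I → ⟶ᵇ-complete (v⟶I z z∈I)
    ... | inj₂ I⟶v = false , λ {z} _ z∈I → ⟶ᵇ-complete′ (asym T z v (I⟶v z z∈I))
  ... | inj₂ ⊤⊆I = inj₂ (inj₁ (⊆-antisym ⊆⊤ (λ _ → ⊤⊆I ∈⊤)))
  ... | inj₁ sub with nonempty? I
  ...   | no empty      = inj₁ (Empty-unique empty)
  ...   | yes (u , u∈I) = inj₂ (inj₂ (u , ⊆-antisym
            (λ z∈I → subst (_∈ ⁅ u ⁆) (sym (sub ∈⊤ z∈I ∈⊤ u∈I)) (x∈⁅x⁆ u))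
            (λ {z} z∈⁅u⁆ → subst (_∈ I) (sym (x∈⁅y⁆⇒x≡y u z∈⁅u⁆)) u∈I)))

  no-proper-interval : ∀ {X I} → IndecomposableOn X → IsIntervalIn X I →
    ∀ {a b c} → a ∈ X → a ∈ I → b ∈ X → b ∈ I → a ≢ b → c ∈ X → c ∉ I → ⊥
  no-proper-interval {I = I} indX I-int a∈X a∈I b∈X b∈I a≢b c∈X c∉I with indX I I-int
  ... | inj₁ sub = a≢b (sub a∈X a∈I b∈X b∈I)
  ... | inj₂ X⊆I = c∉I (X⊆I c∈X)

  no-source-or-sink : ∀ {X} → IndecomposableOn X → AtLeastThree X →
    ∀ {u d} → u ∈ X → ¬ (∀ {z} → z ∈ X → z ≢ u → u ⟶ᵇ z ≡ d)
  no-source-or-sink {X} indX t {u} {d} u∈X u⟶X =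
    let (w , w′ , w∈X , w′∈X , w≢w′ , w≢u , w′≢u) = two-others t u
    in no-proper-interval indX X∖u-interval w∈X (∉⁅u⁆ w≢u) w′∈X (∉⁅u⁆ w′≢u) w≢w′
         u∈X (x∈p⇒x∉∁p (x∈⁅x⁆ u))
    where
    ∉⁅u⁆ : ∀ {z} → z ≢ u → z ∈ ∁ ⁅ u ⁆
    ∉⁅u⁆ = x∉p⇒x∈∁p ∘ x≢y⇒x∉⁅y⁆

    X∖u-interval : IsIntervalIn X (∁ ⁅ u ⁆)
    X∖u-interval v∈X v∉I with x∈⁅y⁆⇒x≡y u (x∉∁p⇒x∈p v∉I)
    ... | refl = d , λ z∈X z∈I → u⟶X z∈X (x∉⁅y⁆⇒x≢y (x∈∁p⇒x∉p z∈I))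

  no-twins : ∀ {X} → IndecomposableOn X → AtLeastThree X →
    ∀ {u u′} → u ∈ X → u′ ∈ X → u ≢ u′ → ¬ (∀ {q} → q ∈ X → q ≢ u → q ≢ u′ → q ⟶ᵇ u ≡ q ⟶ᵇ u′)
  no-twins {X} indX t {u} {u′} u∈X u′∈X u≢u′ same =
    let (w , w∈X , w≢u , w≢u′) = another t u u′
    in no-proper-interval indX pair-interval
         u∈X (x∈p∪q⁺ (inj₁ (x∈⁅x⁆ u))) u′∈X (x∈p∪q⁺ (inj₂ (x∈⁅x⁆ u′))) u≢u′
         w∈X (x∉p∪q⁺ ⁅ u ⁆ ⁅ u′ ⁆ (x≢y⇒x∉⁅y⁆ w≢u) (x≢y⇒x∉⁅y⁆ w≢u′))
    where
    pair-interval : IsIntervalIn X (⁅ u ⁆ ∪ ⁅ u′ ⁆)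
    pair-interval {v} v∈X v∉I = v ⟶ᵇ u , same-side
      where
      same-side : ∀ {z} → z ∈ X → z ∈ ⁅ u ⁆ ∪ ⁅ u′ ⁆ → v ⟶ᵇ z ≡ v ⟶ᵇ u
      same-side z∈X z∈I with x∈p∪q⁻ ⁅ u ⁆ ⁅ u′ ⁆ z∈I
      ... | inj₁ z∈⁅u⁆  rewrite x∈⁅y⁆⇒x≡y u z∈⁅u⁆   = refl
      ... | inj₂ z∈⁅u′⁆ rewrite x∈⁅y⁆⇒x≡y u′ z∈⁅u′⁆ =
        sym (same v∈X (x∉⁅y⁆⇒x≢y (x∉p∪q⇒x∉p v∉I)) (x∉⁅y⁆⇒x≢y (x∉p∪q⇒x∉q v∉I)))

  -- Extension by two vertices

  -- IsUniform v and Mimics u v say v ∈ ⟨X⟩ and v ∈ X(u) in the Ehrenfeucht–Rozenberg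
  -- partition of V ∖ X.
  module _ (X : Subset n) where

    Twins : Fin n → Fin n → Set
    Twins a b = ∀ {z} → z ∈ X → z ⟶ᵇ a ≡ z ⟶ᵇ b

    Mimics : Fin n → Fin n → Set
    Mimics u v = ∀ {z} → z ∈ X → z ≢ u → z ⟶ᵇ u ≡ z ⟶ᵇ v

    IsUniform : Fin n → Set
    IsUniform v = ∃ (Uniform X v)

    -- What a nontrivial interval of X ∪ {a, b} forces when X is indecomposable; the patterns
    -- below name each alternative after the shape of that interval.
    Obstruction : Fin n → Fin n → Set
    Obstruction a b =
        Twins a b
      ⊎ (∃ λ u → u ∈ X × Mimics u a × b ⟶ᵇ u ≡ b ⟶ᵇ a)
      ⊎ (∃ λ u → u ∈ X × Mimics u b × a ⟶ᵇ u ≡ a ⟶ᵇ b)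
      ⊎ (∃ λ u → u ∈ X × Mimics u a × Mimics u b)
      ⊎ (IsUniform a × IsUniform b)
      ⊎ Uniform X b (b ⟶ᵇ a)
      ⊎ Uniform X a (a ⟶ᵇ b)

  pattern ab-interval t          = inj₁ t
  pattern ua-interval u u∈X m e   = inj₂ (inj₁ (u , u∈X , m , e))
  pattern ub-interval u u∈X m e   = inj₂ (inj₂ (inj₁ (u , u∈X , m , e)))
  pattern uab-interval u u∈X m m′ = inj₂ (inj₂ (inj₂ (inj₁ (u , u∈X , m , m′))))
  pattern X-interval ua ub        = inj₂ (inj₂ (inj₂ (inj₂ (inj₁ (ua , ub)))))
  pattern Xa-interval ub          = inj₂ (inj₂ (inj₂ (inj₂ (inj₂ (inj₁ ub)))))
  pattern Xb-interval ua          = inj₂ (inj₂ (inj₂ (inj₂ (inj₂ (inj₂ ua)))))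

  module _ {X : Subset n} {a b : Fin n} {I : Subset n} (Y-int : IsIntervalIn (X ∪⁅ a , b ⁆) I) where

    private
      X⊆Y : X ⊆ X ∪⁅ a , b ⁆
      X⊆Y = p⊆p∪⁅a,b⁆
      a∈Y : a ∈ X ∪⁅ a , b ⁆
      a∈Y = a∈p∪⁅a,b⁆ a
      b∈Y : b ∈ X ∪⁅ a , b ⁆
      b∈Y = b∈p∪⁅a,b⁆ b

    obstruction-if-X⊆I : X ⊆ I → IsTrivialIn (X ∪⁅ a , b ⁆) I ⊎ Obstruction X a b
    obstruction-if-X⊆I X⊆I with a ∈? I | b ∈? I
    ... | yes a∈I | yes b∈I = inj₁ (inj₂ Y⊆I)
      where
      Y⊆I : X ∪⁅ a , b ⁆ ⊆ I
      Y⊆I z∈Y with x∈p∪⁅a,b⁆⁻ X a b z∈Y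
      ... | inj₁ z∈X         = X⊆I z∈X
      ... | inj₂ (inj₁ refl) = a∈I
      ... | inj₂ (inj₂ refl) = b∈I
    ... | yes a∈I | no b∉I  = inj₂ (Xa-interval λ z∈X →
                                interval-same-side Y-int b∈Y b∉I (X⊆Y z∈X) (X⊆I z∈X) a∈Y a∈I)
    ... | no a∉I  | yes b∈I = inj₂ (Xb-interval λ z∈X →
                                interval-same-side Y-int a∈Y a∉I (X⊆Y z∈X) (X⊆I z∈X) b∈Y b∈I)
    ... | no a∉I  | no b∉I  = inj₂ (X-interval (uniform a∈Y a∉I) (uniform b∈Y b∉I))
      where
      uniform : ∀ {v} → v ∈ X ∪⁅ a , b ⁆ → v ∉ I → IsUniform X v
      uniform v∈Y v∉I = let (d , v⟶I) = Y-int v∈Y v∉I in d , λ z∈X → v⟶I (X⊆Y z∈X) (X⊆I z∈X)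

    mimics-if-X∩I⊆⁅u⁆ : ∀ {u c} → u ∈ X → u ∈ I → (∀ {z} → z ∈ X → z ∈ I → z ≡ u) →
      c ∈ X ∪⁅ a , b ⁆ → c ∈ I → Mimics X u c
    mimics-if-X∩I⊆⁅u⁆ u∈X u∈I X∩I⊆u c∈Y c∈I z∈X z≢u =
      interval-same-side Y-int (X⊆Y z∈X) (z≢u ∘ X∩I⊆u z∈X) (X⊆Y u∈X) u∈I c∈Y c∈I

    obstruction-if-X∩I≡⁅u⁆ : ∀ {u} → u ∈ X → u ∈ I → (∀ {z} → z ∈ X → z ∈ I → z ≡ u) →
      IsTrivialIn (X ∪⁅ a , b ⁆) I ⊎ Obstruction X a b
    obstruction-if-X∩I≡⁅u⁆ {u} u∈X u∈I X∩I⊆u with a ∈? I | b ∈? I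
    ... | yes a∈I | yes b∈I = inj₂ (uab-interval u u∈X (mimics-if-X∩I⊆⁅u⁆ u∈X u∈I X∩I⊆u a∈Y a∈I)
                                                  (mimics-if-X∩I⊆⁅u⁆ u∈X u∈I X∩I⊆u b∈Y b∈I))
    ... | yes a∈I | no b∉I  = inj₂ (ua-interval u u∈X (mimics-if-X∩I⊆⁅u⁆ u∈X u∈I X∩I⊆u a∈Y a∈I)
                                (interval-same-side Y-int b∈Y b∉I (X⊆Y u∈X) u∈I a∈Y a∈I))
    ... | no a∉I  | yes b∈I = inj₂ (ub-interval u u∈X (mimics-if-X∩I⊆⁅u⁆ u∈X u∈I X∩I⊆u b∈Y b∈I)
                                (interval-same-side Y-int a∈Y a∉I (X⊆Y u∈X) u∈I b∈Y b∈I))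
    ... | no a∉I  | no b∉I  = inj₁ (trivial-if-⊆⁅⁆ u Y∩I⊆u)
      where
      Y∩I⊆u : ∀ {z} → z ∈ X ∪⁅ a , b ⁆ → z ∈ I → z ≡ u
      Y∩I⊆u z∈Y z∈I with x∈p∪⁅a,b⁆⁻ X a b z∈Y
      ... | inj₁ z∈X         = X∩I⊆u z∈X z∈I
      ... | inj₂ (inj₁ refl) = contradiction z∈I a∉I
      ... | inj₂ (inj₂ refl) = contradiction z∈I b∉I

    obstruction-if-X∩I≡∅ : (∀ {z} → z ∈ X → z ∉ I) → IsTrivialIn (X ∪⁅ a , b ⁆) I ⊎ Obstruction X a b
    obstruction-if-X∩I≡∅ X∩I≡∅ with a ∈? I | b ∈? I
    ... | yes a∈I | yes b∈I = inj₂ (ab-interval λ z∈X →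
                                interval-same-side Y-int (X⊆Y z∈X) (X∩I≡∅ z∈X) a∈Y a∈I b∈Y b∈I)
    ... | yes a∈I | no b∉I  = inj₁ (trivial-if-⊆⁅⁆ a Y∩I⊆a)
      where
      Y∩I⊆a : ∀ {z} → z ∈ X ∪⁅ a , b ⁆ → z ∈ I → z ≡ a
      Y∩I⊆a z∈Y z∈I with x∈p∪⁅a,b⁆⁻ X a b z∈Y
      ... | inj₁ z∈X         = contradiction z∈I (X∩I≡∅ z∈X)
      ... | inj₂ (inj₁ refl) = refl
      ... | inj₂ (inj₂ refl) = contradiction z∈I b∉I
    ... | no a∉I  | _       = inj₁ (trivial-if-⊆⁅⁆ b Y∩I⊆b)
      where
      Y∩I⊆b : ∀ {z} → z ∈ X ∪⁅ a , b ⁆ → z ∈ I → z ≡ b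
      Y∩I⊆b z∈Y z∈I with x∈p∪⁅a,b⁆⁻ X a b z∈Y
      ... | inj₁ z∈X         = contradiction z∈I (X∩I≡∅ z∈X)
      ... | inj₂ (inj₁ refl) = contradiction z∈I a∉I
      ... | inj₂ (inj₂ refl) = refl

  obstruction-or-trivial : ∀ {X} → IndecomposableOn X → ∀ {a b I} → IsIntervalIn (X ∪⁅ a , b ⁆) I →
    IsTrivialIn (X ∪⁅ a , b ⁆) I ⊎ Obstruction X a b
  obstruction-or-trivial {X} indX {I = I} Y-int with indX I (IsIntervalIn-mono p⊆p∪⁅a,b⁆ Y-int)
  ... | inj₂ X⊆I = obstruction-if-X⊆I Y-int X⊆I
  ... | inj₁ X∩I-sub with any? (λ u → u ∈? X ×-dec u ∈? I)
  ...   | yes (u , u∈X , u∈I) = obstruction-if-X∩I≡⁅u⁆ Y-int u∈X u∈I (λ z∈X z∈I → X∩I-sub z∈X z∈I u∈X u∈I)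
  ...   | no X∩I≢∅            = obstruction-if-X∩I≡∅ Y-int (λ z∈X z∈I → X∩I≢∅ (_ , z∈X , z∈I))

  module _ (X : Subset n) where

    ∀∈? : ∀ {ℓ} {P : Pred (Fin n) ℓ} → Decidable P → Dec (∀ {z} → z ∈ X → P z)
    ∀∈? P? = map′ (λ h {z} → h z) (λ h z → h {z}) (all? λ z → z ∈? X →-dec P? z)

    uniform? : ∀ v d → Dec (Uniform X v d)
    uniform? v d = ∀∈? λ z → v ⟶ᵇ z ≟ᵇ d

    isUniform? : ∀ v → Dec (IsUniform X v)
    isUniform? v = ∃-Bool? (uniform? v true) (uniform? v false)

    mimics? : ∀ u v → Dec (Mimics X u v)
    mimics? u v = ∀∈? λ z → ¬? (z ≟ u) →-dec z ⟶ᵇ u ≟ᵇ z ⟶ᵇ v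

    obstruction? : ∀ a b → Dec (Obstruction X a b)
    obstruction? a b =
            ∀∈? (λ z → z ⟶ᵇ a ≟ᵇ z ⟶ᵇ b)
      ⊎-dec any? (λ u → u ∈? X ×-dec mimics? u a ×-dec b ⟶ᵇ u ≟ᵇ b ⟶ᵇ a)
      ⊎-dec any? (λ u → u ∈? X ×-dec mimics? u b ×-dec a ⟶ᵇ u ≟ᵇ a ⟶ᵇ b)
      ⊎-dec any? (λ u → u ∈? X ×-dec mimics? u a ×-dec mimics? u b)
      ⊎-dec isUniform? a ×-dec isUniform? b
      ⊎-dec uniform? b (b ⟶ᵇ a)
      ⊎-dec uniform? a (a ⟶ᵇ b)

  module _ {X : Subset n} (indX : IndecomposableOn X) (t : AtLeastThree X) where

    uniform⇒¬mimics : ∀ {u v d} → u ∈ X → v ∉ X → Uniform X v d → ¬ Mimics X u v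
    uniform⇒¬mimics u∈X v∉X v⟶X v-mimics-u = no-source-or-sink indX t u∈X λ z∈X z≢u →
      trans (⟶ᵇ-flip-cong z≢u (x∈p∧y∉p⇒x≢y z∈X v∉X) (v-mimics-u z∈X z≢u)) (v⟶X z∈X)

    mimics-unique : ∀ {u u′ v} → u ∈ X → u′ ∈ X → Mimics X u v → Mimics X u′ v → u ≡ u′
    mimics-unique u∈X u′∈X v-mimics-u v-mimics-u′ = decidable-stable (_ ≟ _) λ u≢u′ →
      no-twins indX t u∈X u′∈X u≢u′ λ q∈X q≢u q≢u′ → trans (v-mimics-u q∈X q≢u) (sym (v-mimics-u′ q∈X q≢u′))

    crossed-mimics : ∀ {u u′ z w} → u ∈ X → u′ ∈ X → z ∉ X → w ∉ X →
      Mimics X u z → Mimics X u′ w → ¬ Mimics X u w → z ⟶ᵇ u′ ≡ z ⟶ᵇ w → w ⟶ᵇ z ≡ w ⟶ᵇ u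
    crossed-mimics {u} {u′} {z} {w} u∈X u′∈X z∉X w∉X z-mimics-u w-mimics-u′ w-not e =
      ⟶ᵇ-flip-cong z≢w (x∈p∧y∉p⇒x≢y u∈X w∉X) z⟶w≡u⟶w
      where
      z≢w : z ≢ w
      z≢w refl = w-not z-mimics-u

      u′≢u : u′ ≢ u
      u′≢u refl = w-not w-mimics-u′

      z⟶w≡u⟶w : z ⟶ᵇ w ≡ u ⟶ᵇ w
      z⟶w≡u⟶w = begin
        z ⟶ᵇ w   ≡⟨ sym e ⟩
        z ⟶ᵇ u′  ≡⟨ ⟶ᵇ-flip-cong (x∈p∧y∉p⇒x≢y u′∈X z∉X) u′≢u (sym (z-mimics-u u′∈X u′≢u)) ⟩
        u ⟶ᵇ u′  ≡⟨ w-mimics-u′ u∈X (u′≢u ∘ sym) ⟩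
        u ⟶ᵇ w   ∎

    module AllPairsObstructed (indT : IndecomposableOn ⊤)
                              (obstructed : ∀ {a b} → a ∉ X → b ∉ X → Obstruction X a b) where

      open AtLeastThree t

      uniform-agrees : ∀ {c v d} → c ∉ X → Uniform X c d → v ∉ X → ¬ IsUniform X v → c ⟶ᵇ v ≡ d
      uniform-agrees {c} {v} c∉X c⟶X v∉X v-nonuniform with obstructed c∉X v∉X
      ... | ab-interval twins = ⊥-elim (v-nonuniform (_ , λ z∈X →
              trans (sym (⟶ᵇ-flip-cong (x∈p∧y∉p⇒x≢y z∈X c∉X) (x∈p∧y∉p⇒x≢y z∈X v∉X) (twins z∈X))) (c⟶X z∈X)))
      ... | ua-interval u u∈X c-mimics-u _ = ⊥-elim (uniform⇒¬mimics u∈X c∉X c⟶X c-mimics-u)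
      ... | ub-interval u u∈X _ c⟶u≡c⟶v    = trans (sym c⟶u≡c⟶v) (c⟶X u∈X)
      ... | uab-interval u u∈X c-mimics-u _ = ⊥-elim (uniform⇒¬mimics u∈X c∉X c⟶X c-mimics-u)
      ... | X-interval _ v-uniform         = ⊥-elim (v-nonuniform v-uniform)
      ... | Xa-interval v⟶X                = ⊥-elim (v-nonuniform (_ , v⟶X))
      ... | Xb-interval c⟶X∪v              = trans (sym (c⟶X∪v x₀∈X)) (c⟶X x₀∈X)

      outside-not-uniform : ∀ {v} → v ∉ X → ¬ IsUniform X v
      outside-not-uniform {v} v∉X v-uniform =
        no-proper-interval indT S-interval ∈⊤ (inX x₀∈X) ∈⊤ (inX x₁∈X) x₀≢x₁ ∈⊤ v∉S
        where
        S : Subset n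
        S = X ∪ ∁ ⟦ isUniform? X ⟧

        inX : ∀ {z} → z ∈ X → z ∈ S
        inX z∈X = x∈p∪q⁺ (inj₁ z∈X)

        v∉S : v ∉ S
        v∉S = x∉p∪q⁺ X _ v∉X (x∈p⇒x∉∁p (x∈⟦P⟧⁺ (isUniform? X) v-uniform))

        S-interval : IsIntervalIn ⊤ S
        S-interval {c} _ c∉S with x∈⟦P⟧⁻ (isUniform? X) (x∉∁p⇒x∈p (x∉p∪q⇒x∉q c∉S))
        ... | d , c⟶X = d , c⟶S
          where
          c⟶S : ∀ {z} → z ∈ ⊤ → z ∈ S → c ⟶ᵇ z ≡ d
          c⟶S {z} _ z∈S with z ∈? X | x∈p∪q⁻ X _ z∈S
          ... | yes z∈X | _          = c⟶X z∈X
          ... | no z∉X  | inj₁ z∈X   = contradiction z∈X z∉X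
          ... | no z∉X  | inj₂ z∈∁U  = uniform-agrees (x∉p∪q⇒x∉p c∉S) c⟶X z∉X
                                         (x∈∁p⇒x∉p z∈∁U ∘ x∈⟦P⟧⁺ (isUniform? X))

      mimic-agrees : ∀ {u z w} → u ∈ X → z ∉ X → Mimics X u z → w ∉ X → ¬ Mimics X u w →
        w ⟶ᵇ z ≡ w ⟶ᵇ u
      mimic-agrees {u} {z} {w} u∈X z∉X z-mimics-u w∉X w-not with obstructed z∉X w∉X
      ... | ab-interval twins = ⊥-elim (w-not λ q∈X q≢u → trans (z-mimics-u q∈X q≢u) (twins q∈X))
      ... | ua-interval u′ u′∈X z-mimics-u′ w⟶u′≡w⟶z =
              trans (sym w⟶u′≡w⟶z) (cong (w ⟶ᵇ_) (sym (mimics-unique u∈X u′∈X z-mimics-u z-mimics-u′)))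
      ... | ub-interval u′ u′∈X w-mimics-u′ z⟶u′≡z⟶w =
              crossed-mimics u∈X u′∈X z∉X w∉X z-mimics-u w-mimics-u′ w-not z⟶u′≡z⟶w
      ... | uab-interval u′ u′∈X z-mimics-u′ w-mimics-u′ = ⊥-elim (w-not (subst (λ u → Mimics X u w)
              (sym (mimics-unique u∈X u′∈X z-mimics-u z-mimics-u′)) w-mimics-u′))
      ... | X-interval z-uniform _ = ⊥-elim (outside-not-uniform z∉X z-uniform)
      ... | Xa-interval w⟶X       = ⊥-elim (outside-not-uniform w∉X (_ , w⟶X))
      ... | Xb-interval z⟶X       = ⊥-elim (outside-not-uniform z∉X (_ , z⟶X))

      outside-not-mimic : ∀ {u v} → u ∈ X → v ∉ X → ¬ Mimics X u v
      outside-not-mimic {u} {v} u∈X v∉X v-mimics-u =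
        let (w , _ , w∈X , _ , _ , w≢u , _) = two-others t u
        in no-proper-interval indT D-interval
             ∈⊤ (x∈p∪q⁺ (inj₁ (x∈⁅x⁆ u))) ∈⊤ (x∈p∪q⁺ (inj₂ (x∈⟦P⟧⁺ M? (v∉X , v-mimics-u))))
             (x∈p∧y∉p⇒x≢y u∈X v∉X)
             ∈⊤ (x∉p∪q⁺ ⁅ u ⁆ _ (x≢y⇒x∉⁅y⁆ w≢u) λ w∈M → proj₁ (x∈⟦P⟧⁻ M? w∈M) w∈X)
        where
        M? : Decidable (λ z → z ∉ X × Mimics X u z)
        M? z = ¬? (z ∈? X) ×-dec mimics? X u z

        D-interval : IsIntervalIn ⊤ (⁅ u ⁆ ∪ ⟦ M? ⟧)
        D-interval {w} _ w∉D = w ⟶ᵇ u , w⟶D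
          where
          w⟶D : ∀ {z} → z ∈ ⊤ → z ∈ ⁅ u ⁆ ∪ ⟦ M? ⟧ → w ⟶ᵇ z ≡ w ⟶ᵇ u
          w⟶D _ z∈D with x∈p∪q⁻ ⁅ u ⁆ _ z∈D
          ... | inj₁ z∈⁅u⁆ rewrite x∈⁅y⁆⇒x≡y u z∈⁅u⁆ = refl
          ... | inj₂ z∈M with x∈⟦P⟧⁻ M? z∈M | w ∈? X
          ...   | _ , z-mimics-u   | yes w∈X = sym (z-mimics-u w∈X (x∉⁅y⁆⇒x≢y (x∉p∪q⇒x∉p w∉D)))
          ...   | z∉X , z-mimics-u | no w∉X  = mimic-agrees u∈X z∉X z-mimics-u w∉X
                                                 λ w-mimics-u → x∉p∪q⇒x∉q w∉D (x∈⟦P⟧⁺ M? (w∉X , w-mimics-u))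

      outside-twins : ∀ {z a} → z ∉ X → a ∉ X → Twins X z a
      outside-twins z∉X a∉X with obstructed z∉X a∉X
      ... | ab-interval twins           = twins
      ... | ua-interval _ u∈X z-mimics _ = ⊥-elim (outside-not-mimic u∈X z∉X z-mimics)
      ... | ub-interval _ u∈X a-mimics _ = ⊥-elim (outside-not-mimic u∈X a∉X a-mimics)
      ... | uab-interval _ u∈X z-mimics _ = ⊥-elim (outside-not-mimic u∈X z∉X z-mimics)
      ... | X-interval z-uniform _      = ⊥-elim (outside-not-uniform z∉X z-uniform)
      ... | Xa-interval a⟶X             = ⊥-elim (outside-not-uniform a∉X (_ , a⟶X))
      ... | Xb-interval z⟶X             = ⊥-elim (outside-not-uniform z∉X (_ , z⟶X))

      at-most-one-outside : ∀ {a b} → a ∉ X → b ∉ X → a ≡ b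
      at-most-one-outside {a} a∉X b∉X = decidable-stable (_ ≟ _) λ a≢b →
        no-proper-interval indT ∁X-interval ∈⊤ (x∉p⇒x∈∁p a∉X) ∈⊤ (x∉p⇒x∈∁p b∉X) a≢b ∈⊤ (x∈p⇒x∉∁p x₀∈X)
        where
        ∁X-interval : IsIntervalIn ⊤ (∁ X)
        ∁X-interval {w} _ w∉∁X = w ⟶ᵇ a , λ _ z∈∁X →
          outside-twins (x∈∁p⇒x∉p z∈∁X) a∉X (x∉∁p⇒x∈p w∉∁X)

    extend-by-two : IndecomposableOn ⊤ → ∀ {a₀ b₀} → a₀ ∉ X → b₀ ∉ X → a₀ ≢ b₀ →
      ∃ λ a → ∃ λ b → a ∉ X × b ∉ X × a ≢ b × IndecomposableOn (X ∪⁅ a , b ⁆)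
    extend-by-two indT a₀∉X b₀∉X a₀≢b₀
      with any? (λ a → any? (λ b → ¬? (a ∈? X) ×-dec ¬? (b ∈? X) ×-dec ¬? (obstruction? X a b)))
    ... | yes (a , b , a∉X , b∉X , unobstructed) = a , b , a∉X , b∉X , a≢b , indY
      where
      a≢b : a ≢ b
      a≢b refl = unobstructed (ab-interval λ _ → refl)

      indY : IndecomposableOn (X ∪⁅ a , b ⁆)
      indY I I-int = [ id , ⊥-elim ∘ unobstructed ]′ (obstruction-or-trivial indX I-int)
    ... | no none = ⊥-elim (a₀≢b₀ (AllPairsObstructed.at-most-one-outside indT obstructed a₀∉X b₀∉X))
      where
      obstructed : ∀ {a b} → a ∉ X → b ∉ X → Obstruction X a b
      obstructed {a} {b} a∉X b∉X =
        decidable-stable (obstruction? X a b) λ unobstructed → none (a , b , a∉X , b∉X , unobstructed)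

  -- Three-cycles

  cyclic-separation : ∀ {w s r} → w ⟶ᵇ s ≡ true → r ⟶ᵇ w ≡ true → w ⟶ᵇ s ≢ w ⟶ᵇ r
  cyclic-separation w⟶s r⟶w eq
    with () ← trans (sym w⟶s) (trans eq (trans (⟶ᵇ-flip (⟶ᵇ⇒≢ r⟶w)) (cong not r⟶w)))

  module _ {x p q : Fin n} where

    private
      x∈Y : x ∈ ⁅ x ⁆ ∪⁅ p , q ⁆
      x∈Y = p⊆p∪⁅a,b⁆ (x∈⁅x⁆ x)

      p∈Y : p ∈ ⁅ x ⁆ ∪⁅ p , q ⁆
      p∈Y = a∈p∪⁅a,b⁆ p

      q∈Y : q ∈ ⁅ x ⁆ ∪⁅ p , q ⁆
      q∈Y = b∈p∪⁅a,b⁆ q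

      only : ∀ {I} c → x ≡ c ⊎ x ∉ I → p ≡ c ⊎ p ∉ I → q ≡ c ⊎ q ∉ I →
        ∀ {z} → z ∈ ⁅ x ⁆ ∪⁅ p , q ⁆ → z ∈ I → z ≡ c
      only c x≡c∨x∉I p≡c∨p∉I q≡c∨q∉I z∈Y z∈I with x∈⁅x⁆∪⁅p,q⁆⁻ x p q z∈Y
      ... | inj₁ refl        = [ id , contradiction z∈I ]′ x≡c∨x∉I
      ... | inj₂ (inj₁ refl) = [ id , contradiction z∈I ]′ p≡c∨p∉I
      ... | inj₂ (inj₂ refl) = [ id , contradiction z∈I ]′ q≡c∨q∉I

    triangle-indecomposable : x ⟶ᵇ p ≡ true → p ⟶ᵇ q ≡ true → q ⟶ᵇ x ≡ true →
      IndecomposableOn (⁅ x ⁆ ∪⁅ p , q ⁆)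
    triangle-indecomposable x⟶p p⟶q q⟶x I I-int with x ∈? I | p ∈? I | q ∈? I
    ... | yes x∈I | yes p∈I | yes q∈I = inj₂ λ z∈Y → case-on (x∈⁅x⁆∪⁅p,q⁆⁻ x p q z∈Y)
      where
      case-on : ∀ {z} → z ≡ x ⊎ z ≡ p ⊎ z ≡ q → z ∈ I
      case-on (inj₁ refl)         = x∈I
      case-on (inj₂ (inj₁ refl))  = p∈I
      case-on (inj₂ (inj₂ refl))  = q∈I
    ... | yes x∈I | yes p∈I | no q∉I  =
      ⊥-elim (cyclic-separation q⟶x p⟶q (interval-same-side I-int q∈Y q∉I x∈Y x∈I p∈Y p∈I))
    ... | yes x∈I | no p∉I  | yes q∈I =
      ⊥-elim (cyclic-separation p⟶q x⟶p (interval-same-side I-int p∈Y p∉I q∈Y q∈I x∈Y x∈I))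
    ... | no x∉I  | yes p∈I | yes q∈I =
      ⊥-elim (cyclic-separation x⟶p q⟶x (interval-same-side I-int x∈Y x∉I p∈Y p∈I q∈Y q∈I))
    ... | yes x∈I | no p∉I  | no q∉I  = trivial-if-⊆⁅⁆ x (only x (inj₁ refl) (inj₂ p∉I) (inj₂ q∉I))
    ... | no x∉I  | yes p∈I | no q∉I  = trivial-if-⊆⁅⁆ p (only p (inj₂ x∉I) (inj₁ refl) (inj₂ q∉I))
    ... | no x∉I  | no p∉I  | yes q∈I = trivial-if-⊆⁅⁆ q (only q (inj₂ x∉I) (inj₂ p∉I) (inj₁ refl))
    ... | no x∉I  | no p∉I  | no q∉I  = trivial-if-⊆⁅⁆ q (only q (inj₂ x∉I) (inj₂ p∉I) (inj₂ q∉I))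

  module _ (indT : IndecomposableOn ⊤) {x : Fin n}
           (acyclic : ¬ ∃ λ p → ∃ λ q → x ⟶ᵇ p ≡ true × p ⟶ᵇ q ≡ true × q ⟶ᵇ x ≡ true) where

    private
      N⁺? : Decidable (λ z → x ⟶ᵇ z ≡ true)
      N⁺? z = x ⟶ᵇ z ≟ᵇ true

      N⁻? : Decidable (λ z → z ⟶ᵇ x ≡ true)
      N⁻? z = z ⟶ᵇ x ≟ᵇ true

      subsingleton : ∀ {I c z z′} → IsIntervalIn ⊤ I → c ∉ I → z ∈ I → z′ ∈ I → z ≡ z′
      subsingleton I-int c∉I z∈I z′∈I =
        decidable-stable (_ ≟ _) λ z≢z′ → no-proper-interval indT I-int ∈⊤ z∈I ∈⊤ z′∈I z≢z′ ∈⊤ c∉I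

      N⁺-interval : IsIntervalIn ⊤ ⟦ N⁺? ⟧
      N⁺-interval {v} _ v∉N⁺ = true , λ _ z∈N⁺ → v⟶N⁺ (x∈⟦P⟧⁻ N⁺? z∈N⁺)
        where
        v⟶N⁺ : ∀ {z} → x ⟶ᵇ z ≡ true → v ⟶ᵇ z ≡ true
        v⟶N⁺ {z} x⟶z with v ≟ x | v ⟶ᵇ z in v⟶z
        ... | yes refl | _     = trans (sym v⟶z) x⟶z
        ... | no _     | true  = refl
        ... | no v≢x   | false = ⊥-elim (acyclic (z , v , x⟶z , ⟶ᵇ-reverse v≢z v⟶z , v⟶x))
          where
          v≢z : v ≢ z
          v≢z refl = v∉N⁺ (x∈⟦P⟧⁺ N⁺? x⟶z)
          v⟶x : v ⟶ᵇ x ≡ true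
          v⟶x = ⟶ᵇ-reverse (≢-sym v≢x) (¬-not (v∉N⁺ ∘ x∈⟦P⟧⁺ N⁺?))

      N⁻-interval : IsIntervalIn ⊤ ⟦ N⁻? ⟧
      N⁻-interval {v} _ v∉N⁻ = false , λ _ z∈N⁻ → v⟵N⁻ (x∈⟦P⟧⁻ N⁻? z∈N⁻)
        where
        v⟵N⁻ : ∀ {z} → z ⟶ᵇ x ≡ true → v ⟶ᵇ z ≡ false
        v⟵N⁻ {z} z⟶x with v ≟ x | v ⟶ᵇ z in v⟶z
        ... | yes refl | _     = trans (sym v⟶z) (trans (⟶ᵇ-flip (⟶ᵇ⇒≢ z⟶x)) (cong not z⟶x))
        ... | no _     | false = refl
        ... | no v≢x   | true  = ⊥-elim (acyclic (v , z , x⟶v , v⟶z , z⟶x))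
          where
          x⟶v : x ⟶ᵇ v ≡ true
          x⟶v = ⟶ᵇ-reverse v≢x (¬-not (v∉N⁻ ∘ x∈⟦P⟧⁺ N⁻?))

      Position : Fin 3 → Fin n → Set
      Position zero             z = z ≡ x
      Position (suc zero)       z = x ⟶ᵇ z ≡ true
      Position (suc (suc zero)) z = z ⟶ᵇ x ≡ true

      position : ∀ z → ∃ λ i → Position i z
      position z with z ≟ x | x ⟶ᵇ z in x⟶z
      ... | yes z≡x | _     = zero , z≡x
      ... | no _    | true  = suc zero , x⟶z
      ... | no z≢x  | false = suc (suc zero) , ⟶ᵇ-reverse (≢-sym z≢x) x⟶z

      position-unique : ∀ i {z z′} → Position i z → Position i z′ → z ≡ z′
      position-unique zero             z≡x    z′≡x   = trans z≡x (sym z′≡x)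
      position-unique (suc zero)       x⟶z    x⟶z′   =
        subsingleton N⁺-interval x∉N⁺ (x∈⟦P⟧⁺ N⁺? x⟶z) (x∈⟦P⟧⁺ N⁺? x⟶z′)
        where
        x∉N⁺ : x ∉ ⟦ N⁺? ⟧
        x∉N⁺ x∈N⁺ with () ← trans (sym (x∈⟦P⟧⁻ N⁺? x∈N⁺)) (⟶ᵇ-irrefl x)
      position-unique (suc (suc zero)) z⟶x    z′⟶x   =
        subsingleton N⁻-interval x∉N⁻ (x∈⟦P⟧⁺ N⁻? z⟶x) (x∈⟦P⟧⁺ N⁻? z′⟶x)
        where
        x∉N⁻ : x ∉ ⟦ N⁻? ⟧
        x∉N⁻ x∈N⁻ with () ← trans (sym (x∈⟦P⟧⁻ N⁻? x∈N⁻)) (⟶ᵇ-irrefl x)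

    acyclic⇒n≤3 : n ≤ 3
    acyclic⇒n≤3 = ≤-if-covered-by-subsingletons Position position position-unique

  three-cycle-through : IndecomposableOn ⊤ → 3 < n → ∀ x →
    ∃ λ p → ∃ λ q → x ⟶ᵇ p ≡ true × p ⟶ᵇ q ≡ true × q ⟶ᵇ x ≡ true
  three-cycle-through indT 3<n x =
    decidable-stable (any? λ p → any? λ q → x ⟶ᵇ p ≟ᵇ true ×-dec p ⟶ᵇ q ≟ᵇ true ×-dec q ⟶ᵇ x ≟ᵇ true)
      λ acyclic → <⇒≱ 3<n (acyclic⇒n≤3 indT acyclic)

  -- Deleting a vertex

  deletion-outside : IndecomposableOn ⊤ → ∀ j {X} → IndecomposableOn X → AtLeastThree X →
    ∣ ∁ X ∣ ≡ suc (j + j) → ∃ λ y → y ∉ X × IndecomposableOn (∁ ⁅ y ⁆)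
  deletion-outside indT zero {X} indX t ∣∁X∣≡1 with ∣p∣≡suc⇒nonempty ∣∁X∣≡1
  ... | y , y∈∁X = y , y∉X , IndecomposableOn-resp X⊆∁⁅y⁆ ∁⁅y⁆⊆X indX
    where
    y∉X : y ∉ X
    y∉X = x∈∁p⇒x∉p y∈∁X

    X⊆∁⁅y⁆ : X ⊆ ∁ ⁅ y ⁆
    X⊆∁⁅y⁆ z∈X = x∉p⇒x∈∁p (x≢y⇒x∉⁅y⁆ (x∈p∧y∉p⇒x≢y z∈X y∉X))

    X∪⁅y⁆-full : ∀ {z} → z ∈ X ∪ ⁅ y ⁆
    X∪⁅y⁆-full = x∉∁p⇒x∈p (∣p∣≡0⇒x∉p (suc-injective (trans (sym (∣∁p∣≡1+∣∁[p∪⁅x⁆]∣ y∉X)) ∣∁X∣≡1)))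

    ∁⁅y⁆⊆X : ∁ ⁅ y ⁆ ⊆ X
    ∁⁅y⁆⊆X z∈∁⁅y⁆ with x∈p∪q⁻ X ⁅ y ⁆ X∪⁅y⁆-full
    ... | inj₁ z∈X   = z∈X
    ... | inj₂ z∈⁅y⁆ = contradiction z∈⁅y⁆ (x∈∁p⇒x∉p z∈∁⁅y⁆)
  deletion-outside indT (suc j) {X} indX t ∣∁X∣≡odd =
    let (a₀ , b₀ , a₀∉X , b₀∉X , a₀≢b₀)   = two-outside ∣∁X∣≡3+2j
        (a , b , a∉X , b∉X , a≢b , indY) = extend-by-two indX t indT a₀∉X b₀∉X a₀≢b₀
        ∣∁Y∣≡1+2j = suc-injective (suc-injective (trans (sym (∣∁p∣≡2+∣∁[p∪⁅a,b⁆]∣ a∉X b∉X a≢b)) ∣∁X∣≡3+2j))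
        (y , y∉Y , ind∁⁅y⁆) = deletion-outside indT j indY (AtLeastThree-mono p⊆p∪⁅a,b⁆ t) ∣∁Y∣≡1+2j
    in y , y∉Y ∘ p⊆p∪⁅a,b⁆ , ind∁⁅y⁆
    where
    ∣∁X∣≡3+2j : ∣ ∁ X ∣ ≡ suc (suc (suc (j + j)))
    ∣∁X∣≡3+2j = trans ∣∁X∣≡odd (cong suc (+-suc (suc j) j))

module _ {m : ℕ} (T : Tournament (suc m)) where

  open Indecomposability T

  deletion-avoiding : IndecomposableOn ⊤ → 3 < suc m → Even (suc m) →
    ∀ x → ∃ λ y → y ≢ x × IndecomposableOn (∁ ⁅ y ⁆)
  deletion-avoiding indT 3<n (k , n≡k+k) x =
    let (p , q , x⟶p , p⟶q , q⟶x) = three-cycle-through indT 3<n x in from-triangle x⟶p p⟶q q⟶x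
    where
    from-triangle : ∀ {p q} → x ⟶ᵇ p ≡ true → p ⟶ᵇ q ≡ true → q ⟶ᵇ x ≡ true →
      ∃ λ y → y ≢ x × IndecomposableOn (∁ ⁅ y ⁆)
    from-triangle {p} {q} x⟶p p⟶q q⟶x =
      let (j , ∣∁X∣≡1+2j)     = odd-remainder k _ (trans (sym n≡k+k) (cong suc m≡2+∣∁X∣))
          (y , y∉X , ind∁⁅y⁆) = deletion-outside indT j (triangle-indecomposable x⟶p p⟶q q⟶x)
                                  (three x p q x∈X p∈X q∈X x≢p x≢q p≢q) ∣∁X∣≡1+2j
      in y , ≢-sym (x∈p∧y∉p⇒x≢y x∈X y∉X) , ind∁⁅y⁆
      where
      x≢p : x ≢ p
      x≢p = ⟶ᵇ⇒≢ x⟶p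

      x≢q : x ≢ q
      x≢q = ≢-sym (⟶ᵇ⇒≢ q⟶x)

      p≢q : p ≢ q
      p≢q = ⟶ᵇ⇒≢ p⟶q

      x∈X : x ∈ ⁅ x ⁆ ∪⁅ p , q ⁆
      x∈X = p⊆p∪⁅a,b⁆ (x∈⁅x⁆ x)

      p∈X : p ∈ ⁅ x ⁆ ∪⁅ p , q ⁆
      p∈X = a∈p∪⁅a,b⁆ p

      q∈X : q ∈ ⁅ x ⁆ ∪⁅ p , q ⁆
      q∈X = b∈p∪⁅a,b⁆ q

      m≡2+∣∁X∣ : m ≡ suc (suc ∣ ∁ (⁅ x ⁆ ∪⁅ p , q ⁆) ∣)
      m≡2+∣∁X∣ = trans (sym (∣∁⁅x⁆∣≡n x))
        (∣∁p∣≡2+∣∁[p∪⁅a,b⁆]∣ (x≢y⇒x∉⁅y⁆ (≢-sym x≢p)) (x≢y⇒x∉⁅y⁆ (≢-sym x≢q)) p≢q)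

  module _ (y : Fin (suc m)) where

    private
      module T∖y = Indecomposability (delete T y)

    in-image? : ∀ I → Decidable (λ z → ∃ λ a → punchIn y a ≡ z × a ∈ I)
    in-image? I z = any? λ a → punchIn y a ≟ z ×-dec a ∈? I

    image : Subset m → Subset (suc m)
    image I = ⟦ in-image? I ⟧

    punchIn∈image : ∀ {a I} → a ∈ I → punchIn y a ∈ image I
    punchIn∈image {a} {I} a∈I = x∈⟦P⟧⁺ (in-image? I) (a , refl , a∈I)

    x∈image⁻ : ∀ {z I} → z ∈ image I → ∃ λ a → punchIn y a ≡ z × a ∈ I
    x∈image⁻ {I = I} = x∈⟦P⟧⁻ (in-image? I)

    punchIn∈image⁻ : ∀ {a I} → punchIn y a ∈ image I → a ∈ I
    punchIn∈image⁻ {a} {I} punchIn∈I with x∈image⁻ punchIn∈I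
    ... | a′ , punchIn≡ , a′∈I = subst (_∈ I) (punchIn-injective y a′ a punchIn≡) a′∈I

    ⟶ᵇ-delete : ∀ {a b} → T∖y._⟶ᵇ_ a b ≡ punchIn y a ⟶ᵇ punchIn y b
    ⟶ᵇ-delete {a} {b} with punchIn y a ⟶? punchIn y b
    ... | yes arc = trans (T∖y.⟶ᵇ-complete arc) (sym (⟶ᵇ-complete arc))
    ... | no ¬arc = trans (T∖y.⟶ᵇ-complete′ ¬arc) (sym (⟶ᵇ-complete′ ¬arc))

    punchIn∈∁⁅y⁆ : ∀ a → punchIn y a ∈ ∁ ⁅ y ⁆
    punchIn∈∁⁅y⁆ a = x∉p⇒x∈∁p (x≢y⇒x∉⁅y⁆ (punchInᵢ≢i y a))

    IndecomposableOn-delete : IndecomposableOn (∁ ⁅ y ⁆) → T∖y.IndecomposableOn ⊤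
    IndecomposableOn-delete ind I I-int with ind (image I) image-interval
      where
      image-interval : IsIntervalIn (∁ ⁅ y ⁆) (image I)
      image-interval {v} v∈∁⁅y⁆ v∉image
        with a , refl ← punchIn-onto (x∉⁅y⁆⇒x≢y (x∈∁p⇒x∉p v∈∁⁅y⁆))
        with d , a⟶I ← I-int ∈⊤ (v∉image ∘ punchIn∈image) =
        d , λ _ z∈image → let (c , punchIn≡ , c∈I) = x∈image⁻ z∈image in
          subst (λ z → punchIn y a ⟶ᵇ z ≡ d) punchIn≡ (trans (sym ⟶ᵇ-delete) (a⟶I ∈⊤ c∈I))
    ... | inj₁ sub = inj₁ λ {a} {a′} _ a∈I _ a′∈I → punchIn-injective y a a′
            (sub (punchIn∈∁⁅y⁆ a) (punchIn∈image a∈I) (punchIn∈∁⁅y⁆ a′) (punchIn∈image a′∈I))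
    ... | inj₂ ∁⁅y⁆⊆image = inj₂ λ {a} _ → punchIn∈image⁻ (∁⁅y⁆⊆image (punchIn∈∁⁅y⁆ a))

open Indecomposability using (indecomposable⇒IndecomposableOn⊤; IndecomposableOn⊤⇒indecomposable)

corollary8 : ∀ (m : ℕ) (T : Tournament (suc m)) →
    Even (suc m) → suc m ≥ 6 → Indecomposable T →
    ∀ (x : Fin (suc m)) → ∃ λ (y : Fin (suc m)) → (y ≢ x) × Indecomposable (delete T y)
corollary8 m T even 6≤n indec x =
  let (y , y≢x , ind∁⁅y⁆) = deletion-avoiding T (indecomposable⇒IndecomposableOn⊤ T indec) 3<n even x
  in y , y≢x , IndecomposableOn⊤⇒indecomposable (delete T y) (IndecomposableOn-delete T y ind∁⁅y⁆)
  where
  3<n : 3 < suc m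
  3<n = ≤-trans (m≤n+m 4 2) 6≤n
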